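{- Let $k\ge1$ be an integer and let $G$ be a $k$-connected graph with an edge $xy$ such that $si(G/xy)$ is $k$-connected. If $N_G(x)\backslash N_G(y)=\{y,z\}$ for a vertex $z$, then $si(G/xz)$ is $k$-connected.
   Context: $N_G(v)$ is the set of neighbours of $v$ in $G$; $si(H)$ is the simplification of $H$; $G/e$ is contraction of $e$. -}

module Defs where

open import Data.Nat using (ℕ; suc; _<_)
open import Data.Fin using (Fin; punchIn)
open import Data.Fin.Subset using (Subset; _∉_; ∣_∣)
open import Data.Product using (_×_)
open import Data.Sum using (_⊎_)
open import Relation.Nullary using (¬_; Dec)
open import Relation.Binary.PropositionalEquality using (_≡_; _≢_)

record Graph (n : ℕ) : Set₁ where
  field
    Adj     : Fin n → Fin n → Set
    sym     : ∀ {u v} → Adj u v → Adj v u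
    irrefl  : ∀ {u} → ¬ Adj u u
    Adj?    : ∀ u v → Dec (Adj u v)
open Graph public

-- Walks in the graph (given by an adjacency relation) minus the vertex set S:
-- every vertex after the start avoids S.
data Walk {n : ℕ} (A : Fin n → Fin n → Set) (S : Subset n) : Fin n → Fin n → Set where
  here : ∀ {u} → Walk A S u u
  step : ∀ {u v w} → A u v → v ∉ S → Walk A S v w → Walk A S u w

KConnected : {n : ℕ} → ℕ → (Fin n → Fin n → Set) → Set
KConnected {n} k A =
  (k < n) ×
  (∀ (S : Subset n) → ∣ S ∣ < k →
     ∀ u v → u ∉ S → v ∉ S → Walk A S u v)

-- The vertex y is removed: vertices of the result are Fin n, where vertex u
-- stands for the vertex  punchIn y u  of G; the contracted vertex is the
-- (unique) u with punchIn y u ≡ x.  Loops are dropped and parallel edges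
-- merged (adjacency is a relation).
ContractAdj : {n : ℕ} → Graph (suc n) → (x y : Fin (suc n)) → Fin n → Fin n → Set
ContractAdj G x y u v =
  (u ≢ v) ×
  (Adj G (punchIn y u) (punchIn y v)
   ⊎ ((punchIn y u ≡ x) × Adj G y (punchIn y v))
   ⊎ ((punchIn y v ≡ x) × Adj G (punchIn y u) y))

NbhdDiffIs : {n : ℕ} → Graph n → (x y z : Fin n) → Set
NbhdDiffIs G x y z =
  ∀ w → ((Adj G x w × ¬ Adj G y w) → (w ≡ y ⊎ w ≡ z))
      × ((w ≡ y ⊎ w ≡ z) → (Adj G x w × ¬ Adj G y w))

-- Let S be a set of fewer than k vertices of si(G/xz) and Q ⊆ V(G) its preimage
-- under the contraction map (the contracted vertex pulls back to {x, z}). Walks of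
-- G − Q map to walks of si(G/xz) − S, so it suffices that G − Q is connected.
-- If x, z ∉ Q, then |Q| = |S| and G is k-connected. Otherwise x, z ∈ Q and
-- |Q| = |S| + 1. If y ∉ Q, then G − (Q − x) is connected, and as N_G(x) \ N_G(y)
-- = {y, z} every neighbour of x in it is y or a neighbour of y, so walks can be
-- rerouted around x through y. If y ∈ Q, then Q − y is a set of |S| vertices of
-- si(G/xy) containing the contracted vertex, and away from that vertex si(G/xy)
-- is G − {x, y}; so walks of si(G/xy) − (Q − y) are walks of G − Q.
module Submission where

open import Defs hiding (sym)
open import Data.Nat using (ℕ; suc; _≤_; _<_)
open import Data.Nat.Properties using (<-≤-trans; ≤-reflexive)
open import Data.Fin using (Fin; zero; suc; punchIn; punchOut)
open import Data.Fin.Properties using (_≟_; punchIn-punchOut; punchOut-punchIn; punchOut-cong; punchInᵢ≢i)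
open import Data.Fin.Subset using (Subset; _∈_; _∉_; _-_; ⁅_⁆; ∣_∣; inside; outside)
open import Data.Fin.Subset.Properties using (_∈?_; p─q⊆p; x∈p∧x≢y⇒x∈p-y; x∈p⇒∣p-x∣<∣p∣)
open import Data.Vec using (Vec; _∷_; lookup; insertAt; removeAt)
open import Data.Vec.Properties using (lookup⇒[]=; []=⇒lookup; insertAt-lookup; insertAt-punchIn; insertAt-removeAt; removeAt-punchOut)
open import Data.Product using (_×_; _,_; proj₁; proj₂)
open import Data.Sum using (_⊎_; inj₁; inj₂)
open import Data.Empty using (⊥-elim)
open import Function using (_∘_)
open import Relation.Nullary using (yes; no)
open import Relation.Binary.PropositionalEquality
  using (_≡_; _≢_; refl; sym; trans; cong; subst; subst₂; module ≡-Reasoning)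

∈-resp-lookup : ∀ {m n} {p : Subset m} {q : Subset n} {i j} →
                lookup p i ≡ lookup q j → i ∈ p → j ∈ q
∈-resp-lookup {q = q} eq i∈p = lookup⇒[]= _ q (trans (sym eq) ([]=⇒lookup i∈p))

∉-resp-lookup : ∀ {m n} {p : Subset m} {q : Subset n} {i j} →
                lookup p i ≡ lookup q j → i ∉ p → j ∉ q
∉-resp-lookup eq i∉p = i∉p ∘ ∈-resp-lookup (sym eq)

x∉p⇒lookup≡outside : ∀ {n} {p : Subset n} {x} → x ∉ p → lookup p x ≡ outside
x∉p⇒lookup≡outside {p = p} {x} x∉p with lookup p x in eq
... | inside  = ⊥-elim (x∉p (lookup⇒[]= x p eq))
... | outside = refl

∣insertAt-outside∣ : ∀ {n} (p : Subset n) i → ∣ insertAt p i outside ∣ ≡ ∣ p ∣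
∣insertAt-outside∣ p             zero    = refl
∣insertAt-outside∣ (inside ∷ p)  (suc i) = cong suc (∣insertAt-outside∣ p i)
∣insertAt-outside∣ (outside ∷ p) (suc i) = ∣insertAt-outside∣ p i

∣insertAt-inside∣ : ∀ {n} (p : Subset n) i → ∣ insertAt p i inside ∣ ≡ suc ∣ p ∣
∣insertAt-inside∣ p             zero    = refl
∣insertAt-inside∣ (inside ∷ p)  (suc i) = cong suc (∣insertAt-inside∣ p i)
∣insertAt-inside∣ (outside ∷ p) (suc i) = ∣insertAt-inside∣ p i

x∈p⇒∣removeAt∣<∣p∣ : ∀ {n} {p : Subset (suc n)} {x} → x ∈ p → ∣ removeAt p x ∣ < ∣ p ∣
x∈p⇒∣removeAt∣<∣p∣ {p = p} {x} x∈p = ≤-reflexive (begin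
  suc ∣ removeAt p x ∣                         ≡⟨ sym (∣insertAt-inside∣ (removeAt p x) x) ⟩
  ∣ insertAt (removeAt p x) x inside ∣         ≡⟨ cong (∣_∣ ∘ insertAt (removeAt p x) x) (sym ([]=⇒lookup x∈p)) ⟩
  ∣ insertAt (removeAt p x) x (lookup p x) ∣   ≡⟨ cong ∣_∣ (insertAt-removeAt p x) ⟩
  ∣ p ∣                                        ∎)
  where open ≡-Reasoning

x∉p∧y∈p⇒x≢y : ∀ {n} {p : Subset n} {x y} → x ∉ p → y ∈ p → x ≢ y
x∉p∧y∈p⇒x≢y x∉p y∈p refl = x∉p y∈p

removeAt-punchIn : ∀ {n} {A : Set} (xs : Vec A (suc n)) i j →
                   lookup (removeAt xs i) j ≡ lookup xs (punchIn i j)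
removeAt-punchIn xs i j =
  trans (cong (lookup (removeAt xs i)) (sym (punchOut-punchIn i)))
        (removeAt-punchOut xs (punchInᵢ≢i i j ∘ sym))

module _ {n : ℕ} {A : Fin n → Fin n → Set} {S : Subset n} where

  _◅◅_ : ∀ {a b c} → Walk A S a b → Walk A S b c → Walk A S a c
  here         ◅◅ w′ = w′
  step e v∉S w ◅◅ w′ = step e v∉S (w ◅◅ w′)

mapWalk : ∀ {m n} {A : Fin m → Fin m → Set} {B : Fin n → Fin n → Set}
          {R : Subset m} {S : Subset n} (f : Fin m → Fin n) →
          (∀ {p q} → p ∉ R → q ∉ R → A p q → f p ≡ f q ⊎ B (f p) (f q)) →
          (∀ {p} → p ∉ R → f p ∉ S) →
          ∀ {a b} → a ∉ R → Walk A R a b → Walk B S (f a) (f b)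
mapWalk f edge avoid a∉R here = here
mapWalk {B = B} {S = S} f edge avoid {b = b} a∉R (step e q∉R w) with edge a∉R q∉R e
... | inj₁ fa≡fq = subst (λ v → Walk B S v (f b)) (sym fa≡fq) (mapWalk f edge avoid q∉R w)
... | inj₂ e′    = step e′ (avoid q∉R) (mapWalk f edge avoid q∉R w)

-- With punchIn z c ≡ x, this is the vertex map V(G) → V(si(G/xz)) in the
-- indexing of ContractAdj.
module Collapse {n : ℕ} (z : Fin (suc n)) (c : Fin n) where

  collapse : Fin (suc n) → Fin n
  collapse p with z ≟ p
  ... | yes _   = c
  ... | no z≢p = punchOut z≢p

  collapse-punchIn : ∀ i → collapse (punchIn z i) ≡ i
  collapse-punchIn i with z ≟ punchIn z i
  ... | yes z≡ = ⊥-elim (punchInᵢ≢i z i (sym z≡))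
  ... | no z≢  = trans (punchOut-cong z refl) (punchOut-punchIn z)

  collapse⁻¹ : Subset n → Subset (suc n)
  collapse⁻¹ S = insertAt S z (lookup S c)

  ∉collapse⁻¹ : ∀ {S p} → p ∉ collapse⁻¹ S → collapse p ∉ S
  ∉collapse⁻¹ {S} {p} p∉ with z ≟ p
  ... | yes refl = ∉-resp-lookup (insertAt-lookup S z (lookup S c)) p∉
  ... | no z≢p  = ∉-resp-lookup lookup≡ p∉
    where
    lookup≡ : lookup (collapse⁻¹ S) p ≡ lookup S (punchOut z≢p)
    lookup≡ = trans (cong (lookup (collapse⁻¹ S)) (sym (punchIn-punchOut z≢p)))
                    (insertAt-punchIn S z _ (punchOut z≢p))

  punchIn∉collapse⁻¹ : ∀ {S i} → i ∉ S → punchIn z i ∉ collapse⁻¹ S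
  punchIn∉collapse⁻¹ {S} {i} = ∉-resp-lookup (sym (insertAt-punchIn S z _ i))

  punchIn∈collapse⁻¹ : ∀ {S i} → i ∈ S → punchIn z i ∈ collapse⁻¹ S
  punchIn∈collapse⁻¹ {S} {i} = ∈-resp-lookup (sym (insertAt-punchIn S z _ i))

  z∈collapse⁻¹ : ∀ {S} → c ∈ S → z ∈ collapse⁻¹ S
  z∈collapse⁻¹ {S} = ∈-resp-lookup (sym (insertAt-lookup S z (lookup S c)))

  ∣collapse⁻¹∣-∉ : ∀ {S} → c ∉ S → ∣ collapse⁻¹ S ∣ ≡ ∣ S ∣
  ∣collapse⁻¹∣-∉ {S} c∉S rewrite x∉p⇒lookup≡outside c∉S = ∣insertAt-outside∣ S z

  ∣collapse⁻¹∣-∈ : ∀ {S} → c ∈ S → ∣ collapse⁻¹ S ∣ ≡ suc ∣ S ∣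
  ∣collapse⁻¹∣-∈ {S} c∈S rewrite []=⇒lookup c∈S = ∣insertAt-inside∣ S z

adj⇒≢ : ∀ {n} (G : Graph n) {u v} → Adj G u v → v ≢ u
adj⇒≢ G e refl = irrefl G e

ContractEdge : ∀ {n} → Graph (suc n) → (x y : Fin (suc n)) → Fin n → Fin n → Set
ContractEdge G x y u v =
  Adj G (punchIn y u) (punchIn y v)
  ⊎ ((punchIn y u ≡ x) × Adj G y (punchIn y v))
  ⊎ ((punchIn y v ≡ x) × Adj G (punchIn y u) y)

module _ {n : ℕ} (G : Graph (suc n)) {x y : Fin (suc n)} where

  contractEdge⇒≡⊎contractAdj : ∀ {u v} → ContractEdge G x y u v → u ≡ v ⊎ ContractAdj G x y u v
  contractEdge⇒≡⊎contractAdj {u} {v} e with u ≟ v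
  ... | yes u≡v = inj₁ u≡v
  ... | no u≢v  = inj₂ (u≢v , e)

  contractAdj⇒adj : ∀ {u v} → ContractAdj G x y u v →
                    punchIn y u ≢ x → punchIn y v ≢ x → Adj G (punchIn y u) (punchIn y v)
  contractAdj⇒adj (_ , inj₁ e)                 _   _   = e
  contractAdj⇒adj (_ , inj₂ (inj₁ (u≡x , _))) u≢x _   = ⊥-elim (u≢x u≡x)
  contractAdj⇒adj (_ , inj₂ (inj₂ (v≡x , _))) _   v≢x = ⊥-elim (v≢x v≡x)

  liftWalk : ∀ {Q : Subset (suc n)} → x ∈ Q →
             ∀ {a b} → a ∉ removeAt Q y → Walk (ContractAdj G x y) (removeAt Q y) a b →
             Walk (Adj G) Q (punchIn y a) (punchIn y b)
  liftWalk {Q} x∈Q = mapWalk (punchIn y) edge avoid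
    where
    avoid : ∀ {c} → c ∉ removeAt Q y → punchIn y c ∉ Q
    avoid {c} = ∉-resp-lookup (removeAt-punchIn Q y c)
    ≢x : ∀ {c} → c ∉ removeAt Q y → punchIn y c ≢ x
    ≢x c∉ y≡x = avoid c∉ (subst (_∈ Q) (sym y≡x) x∈Q)
    edge : ∀ {c d} → c ∉ removeAt Q y → d ∉ removeAt Q y → ContractAdj G x y c d →
           punchIn y c ≡ punchIn y d ⊎ Adj G (punchIn y c) (punchIn y d)
    edge c∉ d∉ e = inj₂ (contractAdj⇒adj e (≢x c∉) (≢x d∉))

module _ {n : ℕ} (G : Graph (suc n)) {x z : Fin (suc n)} (z≢x : z ≢ x) where

  open Collapse z (punchOut z≢x)

  collapse-adj : ∀ {p q} → Adj G p q → collapse p ≡ collapse q ⊎ ContractAdj G x z (collapse p) (collapse q)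
  collapse-adj {p} {q} e with z ≟ p | z ≟ q
  ... | yes refl | yes refl = ⊥-elim (adj⇒≢ G e refl)
  ... | yes refl | no z≢q  = contractEdge⇒≡⊎contractAdj G
        (inj₂ (inj₁ (punchIn-punchOut z≢x , subst (Adj G z) (sym (punchIn-punchOut z≢q)) e)))
  ... | no z≢p  | yes refl = contractEdge⇒≡⊎contractAdj G
        (inj₂ (inj₂ (punchIn-punchOut z≢x , subst (λ w → Adj G w z) (sym (punchIn-punchOut z≢p)) e)))
  ... | no z≢p  | no z≢q  = contractEdge⇒≡⊎contractAdj G
        (inj₁ (subst₂ (Adj G) (sym (punchIn-punchOut z≢p)) (sym (punchIn-punchOut z≢q)) e))

  collapseWalk : ∀ {S a b} → a ∉ collapse⁻¹ S → Walk (Adj G) (collapse⁻¹ S) a b →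
                 Walk (ContractAdj G x z) S (collapse a) (collapse b)
  collapseWalk = mapWalk collapse (λ _ _ → collapse-adj) ∉collapse⁻¹

module Bypass {n : ℕ} (G : Graph n) {x y : Fin n} (y≢x : y ≢ x) {R R′ : Subset n}
  (y∉R : y ∉ R)
  (x-nbhd : ∀ {w} → w ∉ R → Adj G x w → w ≡ y ⊎ Adj G y w)
  (R′⊆R∪x : ∀ {p} → p ∉ R → p ≢ x → p ∉ R′) where

  toY : ∀ {a} → a ∉ R → Adj G x a → Walk (Adj G) R′ a y
  toY a∉R x~a with x-nbhd a∉R x~a
  ... | inj₁ refl = here
  ... | inj₂ y~a  = step (Graph.sym G y~a) (R′⊆R∪x y∉R y≢x) here

  fromY : ∀ {r} → r ∉ R → Adj G x r → Walk (Adj G) R′ y r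
  fromY r∉R x~r with x-nbhd r∉R x~r
  ... | inj₁ refl = here
  ... | inj₂ y~r  = step y~r (R′⊆R∪x r∉R (adj⇒≢ G x~r)) here

  -- A visit a → x → r is replaced by a ⇝ y ⇝ r.
  bypass : ∀ {a b} → a ∉ R → b ≢ x → Walk (Adj G) R a b → Walk (Adj G) R′ a b
  bypass a∉R b≢x here = here
  bypass a∉R b≢x (step {v = q} e q∉R w) with q ≟ x
  ... | no q≢x = step e (R′⊆R∪x q∉R q≢x) (bypass q∉R b≢x w)
  ... | yes refl with w
  ...   | here            = ⊥-elim (b≢x refl)
  ...   | step x~r r∉R w′ = toY a∉R (Graph.sym G e) ◅◅ (fromY r∉R x~r ◅◅ bypass r∉R b≢x w′)

module ContractionAlongXZ {k n : ℕ} (G : Graph (suc n)) {x y z : Fin (suc n)}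
  (Gk : KConnected k (Adj G)) (Hk : KConnected k (ContractAdj G x y))
  (N : NbhdDiffIs G x y z) where

  x~y : Adj G x y
  x~y = proj₁ (proj₂ (N y) (inj₁ refl))

  x~z : Adj G x z
  x~z = proj₁ (proj₂ (N z) (inj₂ refl))

  y≢x : y ≢ x
  y≢x = adj⇒≢ G x~y

  z≢x : z ≢ x
  z≢x = adj⇒≢ G x~z

  x-nbhd : ∀ {w} → w ≢ z → Adj G x w → w ≡ y ⊎ Adj G y w
  x-nbhd {w} w≢z x~w with Adj? G y w
  ... | yes y~w = inj₂ y~w
  ... | no y≁w with proj₁ (N w) (x~w , y≁w)
  ...   | inj₁ w≡y = inj₁ w≡y
  ...   | inj₂ w≡z = ⊥-elim (w≢z w≡z)

  c : Fin n
  c = punchOut z≢x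

  open Collapse z c

  module Separator (S : Subset n) (∣S∣<k : ∣ S ∣ < k) where

    Q : Subset (suc n)
    Q = collapse⁻¹ S

    walk-in-G : c ∉ S → ∀ {a b} → a ∉ Q → b ∉ Q → Walk (Adj G) Q a b
    walk-in-G c∉S {a} {b} = proj₂ Gk Q (subst (_< k) (sym (∣collapse⁻¹∣-∉ c∉S)) ∣S∣<k) a b

    module _ (c∈S : c ∈ S) where

      x∈Q : x ∈ Q
      x∈Q = subst (_∈ Q) (punchIn-punchOut z≢x) (punchIn∈collapse⁻¹ c∈S)

      ∣Q∣≤k : ∣ Q ∣ ≤ k
      ∣Q∣≤k = subst (_≤ k) (sym (∣collapse⁻¹∣-∈ c∈S)) ∣S∣<k

      walk-around-x : y ∉ Q → ∀ {a b} → a ∉ Q → b ∉ Q → Walk (Adj G) Q a b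
      walk-around-x y∉Q {a} {b} a∉Q b∉Q =
        bypass (∉Q⇒∉R a∉Q) (x∉p∧y∈p⇒x≢y b∉Q x∈Q)
          (proj₂ Gk R (<-≤-trans (x∈p⇒∣p-x∣<∣p∣ x∈Q) ∣Q∣≤k) a b (∉Q⇒∉R a∉Q) (∉Q⇒∉R b∉Q))
        where
        R : Subset (suc n)
        R = Q - x
        ∉Q⇒∉R : ∀ {p} → p ∉ Q → p ∉ R
        ∉Q⇒∉R p∉Q = p∉Q ∘ p─q⊆p Q ⁅ x ⁆
        z∈R : z ∈ R
        z∈R = x∈p∧x≢y⇒x∈p-y (z∈collapse⁻¹ c∈S) z≢x
        open Bypass G y≢x (∉Q⇒∉R y∉Q) (λ w∉R → x-nbhd (x∉p∧y∈p⇒x≢y w∉R z∈R))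
          (λ p∉R p≢x p∈Q → p∉R (x∈p∧x≢y⇒x∈p-y p∈Q p≢x))

      walk-in-G/xy : y ∈ Q → ∀ {a b} → a ∉ Q → b ∉ Q → Walk (Adj G) Q a b
      walk-in-G/xy y∈Q {a} {b} a∉Q b∉Q =
        subst₂ (Walk (Adj G) Q) (punchIn-punchOut (y≢ a∉Q)) (punchIn-punchOut (y≢ b∉Q))
          (liftWalk G x∈Q (punchOut∉T a∉Q)
            (proj₂ Hk T (<-≤-trans (x∈p⇒∣removeAt∣<∣p∣ y∈Q) ∣Q∣≤k) _ _
              (punchOut∉T a∉Q) (punchOut∉T b∉Q)))
        where
        T : Subset n
        T = removeAt Q y
        y≢ : ∀ {p} → p ∉ Q → y ≢ p
        y≢ p∉Q = x∉p∧y∈p⇒x≢y p∉Q y∈Q ∘ sym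
        punchOut∉T : ∀ {p} (p∉Q : p ∉ Q) → punchOut (y≢ p∉Q) ∉ T
        punchOut∉T p∉Q = ∉-resp-lookup (sym (removeAt-punchOut Q (y≢ p∉Q))) p∉Q

    walk-avoiding-Q : ∀ {a b} → a ∉ Q → b ∉ Q → Walk (Adj G) Q a b
    walk-avoiding-Q with c ∈? S | y ∈? Q
    ... | no c∉S  | _       = walk-in-G c∉S
    ... | yes c∈S | no y∉Q  = walk-around-x c∈S y∉Q
    ... | yes c∈S | yes y∈Q = walk-in-G/xy c∈S y∈Q

  si-G/xz-connected : ∀ (S : Subset n) → ∣ S ∣ < k →
                      ∀ u v → u ∉ S → v ∉ S → Walk (ContractAdj G x z) S u v
  si-G/xz-connected S ∣S∣<k u v u∉S v∉S =
    subst₂ (Walk (ContractAdj G x z) S) (collapse-punchIn u) (collapse-punchIn v)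
      (collapseWalk G z≢x (punchIn∉collapse⁻¹ u∉S)
        (walk-avoiding-Q (punchIn∉collapse⁻¹ u∉S) (punchIn∉collapse⁻¹ v∉S)))
    where open Separator S ∣S∣<k

lemma7 : (k n : ℕ) → 1 ≤ k → (G : Graph (suc n)) → (x y z : Fin (suc n)) →
    KConnected k (Adj G) → Adj G x y → KConnected k (ContractAdj G x y) →
    NbhdDiffIs G x y z → KConnected k (ContractAdj G x z)
lemma7 k n _ G x y z Gk _ Hk N =
  proj₁ Hk , ContractionAlongXZ.si-G/xz-connected G Gk Hk N
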